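{- Let $G$ be a finite simple graph with $n$ vertices such that $\varphi^{(4)}(G)\neq2$. Then for every natural number $s\geq4$, $$\varphi^{(s)}(G)\geq\frac{n}{n-D_4(G)}.$$
   Context: Let $d(v)$ denote the degree of $v$. For nonempty $W\subseteq V(G)$ and natural $k$, $D_k(W)=\left(\frac{1}{|W|}\sum_{v\in W}d^k(v)\right)^{1/k}$ and $D_k(G)=D_k(V(G))$. $W$ is a $\delta_k$-small set if $D_k(W)\leq n-|W|$. $\varphi^{(s)}(G)$ is the smallest natural number $r$ such that $V(G)$ is a disjoint union of $r$ $\delta_s$-small sets. -}

module Defs where

open import Data.Nat using (ℕ; zero; suc; _+_; _*_; _∸_; _^_; _≤_)
open import Data.Fin using (Fin; zero; suc; _≟_)
open import Data.Bool using (Bool; true; false; if_then_else_)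
open import Data.Product using (Σ; _×_)
open import Relation.Binary.PropositionalEquality using (_≡_)
open import Relation.Nullary.Decidable using (⌊_⌋)

sumFin : (n : ℕ) → (Fin n → ℕ) → ℕ
sumFin zero    f = 0
sumFin (suc n) f = f zero + sumFin n (λ i → f (suc i))

record SimpleGraph (n : ℕ) : Set where
  field
    adj       : Fin n → Fin n → Bool
    symmetric : ∀ u v → adj u v ≡ adj v u
    loopless  : ∀ v → adj v v ≡ false
open SimpleGraph public

degree : ∀ {n} → SimpleGraph n → Fin n → ℕ
degree {n} G v = sumFin n (λ u → if adj G v u then 1 else 0)

-- For a partition given by a colouring c : Fin n → Fin r, the class W_i = c⁻¹(i).
-- |W_i|
classSize : ∀ {n r} → (Fin n → Fin r) → Fin r → ℕ
classSize {n} c i = sumFin n (λ v → if ⌊ c v ≟ i ⌋ then 1 else 0)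

classPowerSum : ∀ {n r} → SimpleGraph n → ℕ → (Fin n → Fin r) → Fin r → ℕ
classPowerSum {n} G k c i = sumFin n (λ v → if ⌊ c v ≟ i ⌋ then degree G v ^ k else 0)

powerSum : ∀ {n} → SimpleGraph n → ℕ → ℕ
powerSum {n} G k = sumFin n (λ v → degree G v ^ k)

-- W_i is a δ_k-small set: W_i nonempty and D_k(W_i) ≤ n - |W_i|.
-- Since both sides are ≥ 0 and |W_i| > 0, D_k(W) ≤ n - |W| is equivalent to
--   Σ_{v∈W} d(v)^k ≤ |W| · (n - |W|)^k   (raise to the k-th power, multiply by |W|).
IsSmallClass : ∀ {n r} → SimpleGraph n → ℕ → (Fin n → Fin r) → Fin r → Set
IsSmallClass {n} G k c i =
  1 ≤ classSize c i × classPowerSum G k c i ≤ classSize c i * (n ∸ classSize c i) ^ k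

HasSmallPartition : ∀ {n} → SimpleGraph n → ℕ → ℕ → Set
HasSmallPartition {n} G k r = Σ (Fin n → Fin r) (λ c → ∀ i → IsSmallClass G k c i)

IsPhi : ∀ {n} → SimpleGraph n → ℕ → ℕ → Set
IsPhi G k r = HasSmallPartition G k r × (∀ r′ → HasSmallPartition G k r′ → r ≤ r′)

module Submission where

-- The proof has two independent halves.
-- (1) Power means increase with the exponent, so a δ_s-small set is δ_k-small for
--     1 ≤ k ≤ s.  One step k+1 ↦ k follows by summing the weighted AM–GM inequality
--     (k+1)·m·d^k ≤ k·d^(k+1) + m^(k+1) over the set, with m = n − |W|.
-- (2) For a δ_4-small partition W_1, …, W_r we have Σ d^4 ≤ Σ |W_i|·(n − |W_i|)^4,
--     and this is at most n^5·(r − 1)^4 / r^4 unless r = 2: for r ≥ 4 by the tangent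
--     line of x·(1 − x)^4 at x = 1/r (the linear terms cancel since Σ |W_i| = n), for
--     r = 3 by an explicit polynomial inequality, and for r ≤ 1 because G is edgeless.
-- The case r = 2 is excluded through φ^(4)(G) ≠ 2, which then forces φ^(4)(G) ≤ 1.
-- The file first develops finite sums and sums over colour classes, then (1), then (2).

open import Defs
open import Data.Nat using (ℕ; zero; suc; _+_; _*_; _∸_; _^_; _≤_; z≤n; s≤s)
open import Data.Nat.Properties hiding (_≟_)
open import Data.Nat.Solver using (module +-*-Solver)
open import Data.Fin using (Fin; zero; suc; _≟_)
open import Data.Bool using (Bool; true; false; if_then_else_)
open import Data.Product using (_,_; proj₁; proj₂)
open import Data.Sum using (inj₁; inj₂)
open import Function using (_∘_; id)
open import Relation.Binary.PropositionalEquality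
open import Relation.Nullary.Decidable using (⌊_⌋; yes; no)
open import Algebra.Properties.Semiring.Sum +-*-semiring
  using (sum; ∑-distrib-+; ∑-comm; *-distribˡ-sum)
open +-*-Solver

-- The recursive sum of Defs is the library's vector sum, whose algebra we reuse.
sumFin≡sum : ∀ n (f : Fin n → ℕ) → sumFin n f ≡ sum f
sumFin≡sum zero    f = refl
sumFin≡sum (suc n) f = cong (f zero +_) (sumFin≡sum n (f ∘ suc))

sumFin-cong : ∀ n {f g : Fin n → ℕ} → (∀ i → f i ≡ g i) → sumFin n f ≡ sumFin n g
sumFin-cong zero    eq = refl
sumFin-cong (suc n) eq = cong₂ _+_ (eq zero) (sumFin-cong n (eq ∘ suc))

sumFin-mono : ∀ n {f g : Fin n → ℕ} → (∀ i → f i ≤ g i) → sumFin n f ≤ sumFin n g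
sumFin-mono zero    le = z≤n
sumFin-mono (suc n) le = +-mono-≤ (le zero) (sumFin-mono n (le ∘ suc))

sumFin-const : ∀ n a → sumFin n (λ _ → a) ≡ n * a
sumFin-const zero    a = refl
sumFin-const (suc n) a = cong (a +_) (sumFin-const n a)

sumFin-+ : ∀ n (f g : Fin n → ℕ) → sumFin n (λ i → f i + g i) ≡ sumFin n f + sumFin n g
sumFin-+ n f g = begin
  sumFin n (λ i → f i + g i)  ≡⟨ sumFin≡sum n _ ⟩
  sum (λ i → f i + g i)       ≡⟨ ∑-distrib-+ f g ⟩
  sum f + sum g               ≡⟨ sym (cong₂ _+_ (sumFin≡sum n f) (sumFin≡sum n g)) ⟩
  sumFin n f + sumFin n g     ∎
  where open ≡-Reasoning

sumFin-*ˡ : ∀ n a (f : Fin n → ℕ) → sumFin n (λ i → a * f i) ≡ a * sumFin n f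
sumFin-*ˡ n a f = begin
  sumFin n (λ i → a * f i)  ≡⟨ sumFin≡sum n _ ⟩
  sum (λ i → a * f i)       ≡⟨ sym (*-distribˡ-sum a f) ⟩
  a * sum f                 ≡⟨ cong (a *_) (sym (sumFin≡sum n f)) ⟩
  a * sumFin n f            ∎
  where open ≡-Reasoning

sumFin-comm : ∀ r n (F : Fin r → Fin n → ℕ) →
  sumFin r (λ i → sumFin n (F i)) ≡ sumFin n (λ v → sumFin r (λ i → F i v))
sumFin-comm r n F = begin
  sumFin r (λ i → sumFin n (F i))        ≡⟨ sumFin-cong r (λ i → sumFin≡sum n (F i)) ⟩
  sumFin r (λ i → sum (F i))             ≡⟨ sumFin≡sum r _ ⟩
  sum (λ i → sum (F i))                  ≡⟨ ∑-comm F ⟩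
  sum (λ v → sum (λ i → F i v))          ≡⟨ sym (sumFin≡sum n _) ⟩
  sumFin n (λ v → sum (λ i → F i v))     ≡⟨ sumFin-cong n (λ v → sym (sumFin≡sum r (λ i → F i v))) ⟩
  sumFin n (λ v → sumFin r (λ i → F i v)) ∎
  where open ≡-Reasoning

sumFin-affine : ∀ r (w : Fin r → ℕ) p q → sumFin r (λ i → p * w i + q) ≡ p * sumFin r w + r * q
sumFin-affine r w p q =
  trans (sumFin-+ r (λ i → p * w i) (λ _ → q)) (cong₂ _+_ (sumFin-*ˡ r p w) (sumFin-const r q))

sumFin-select : ∀ r (j : Fin r) x → sumFin r (λ i → if ⌊ j ≟ i ⌋ then x else 0) ≡ x
sumFin-select (suc r) zero    x = trans (cong (x +_) (sumFin-const r 0)) (trans (cong (x +_) (*-zeroʳ r)) (+-identityʳ x))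
sumFin-select (suc r) (suc j) x =
  trans (sumFin-cong r (λ i → cong (λ b → if b then x else 0) (suc≟suc i))) (sumFin-select r j x)
  where
  suc≟suc : ∀ i → ⌊ suc j ≟ suc i ⌋ ≡ ⌊ j ≟ i ⌋
  suc≟suc i with j ≟ i
  ... | yes _ = refl
  ... | no  _ = refl

-- Σ_{v ∈ B} f v, for the subset B ⊆ Fin N with indicator b.  Colour-class sums
-- (classSize, classPowerSum) are definitionally of this form.
restrictedSum : ∀ {N} → (Fin N → Bool) → (Fin N → ℕ) → ℕ
restrictedSum {N} b f = sumFin N (λ v → if b v then f v else 0)

restricted-mono : ∀ {N} (b : Fin N → Bool) {f g : Fin N → ℕ} →
  (∀ v → f v ≤ g v) → restrictedSum b f ≤ restrictedSum b g
restricted-mono {N} b le = sumFin-mono N (λ v → pointwise (b v) (le v))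
  where
  pointwise : ∀ β {x y} → x ≤ y → (if β then x else 0) ≤ (if β then y else 0)
  pointwise true  x≤y = x≤y
  pointwise false _   = z≤n

restricted≤total : ∀ {N} (b : Fin N → Bool) (f : Fin N → ℕ) → restrictedSum b f ≤ sumFin N f
restricted≤total {N} b f = sumFin-mono N (λ v → pointwise (b v))
  where
  pointwise : ∀ β {x} → (if β then x else 0) ≤ x
  pointwise true  = ≤-refl
  pointwise false = z≤n

restricted-+ : ∀ {N} (b : Fin N → Bool) (f g : Fin N → ℕ) →
  restrictedSum b (λ v → f v + g v) ≡ restrictedSum b f + restrictedSum b g
restricted-+ {N} b f g =
  trans (sumFin-cong N (λ v → pointwise (b v))) (sumFin-+ N _ _)
  where
  pointwise : ∀ β {x y} → (if β then x + y else 0) ≡ (if β then x else 0) + (if β then y else 0)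
  pointwise true  = refl
  pointwise false = refl

restricted-*ˡ : ∀ {N} (b : Fin N → Bool) a (f : Fin N → ℕ) →
  restrictedSum b (λ v → a * f v) ≡ a * restrictedSum b f
restricted-*ˡ {N} b a f =
  trans (sumFin-cong N (λ v → pointwise (b v))) (sumFin-*ˡ N a _)
  where
  pointwise : ∀ β {x} → (if β then a * x else 0) ≡ a * (if β then x else 0)
  pointwise true  = refl
  pointwise false = sym (*-zeroʳ a)

restricted-const : ∀ {N} (b : Fin N → Bool) a →
  restrictedSum b (λ _ → a) ≡ a * restrictedSum b (λ _ → 1)
restricted-const {N} b a =
  trans (sumFin-cong N (λ v → cong (λ x → if b v then x else 0) (sym (*-identityʳ a))))
        (restricted-*ˡ b a (λ _ → 1))

partitionSum : ∀ {n r} (c : Fin n → Fin r) (f : Fin n → ℕ) →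
  sumFin r (λ i → restrictedSum (λ v → ⌊ c v ≟ i ⌋) f) ≡ sumFin n f
partitionSum {n} {r} c f =
  trans (sumFin-comm r n (λ i v → if ⌊ c v ≟ i ⌋ then f v else 0))
        (sumFin-cong n (λ v → sumFin-select r (c v) (f v)))

classSizes-sum : ∀ {n r} (c : Fin n → Fin r) → sumFin r (classSize c) ≡ n
classSizes-sum {n} c = trans (partitionSum c (λ _ → 1)) (trans (sumFin-const n 1) (*-identityʳ n))

classPowerSums-sum : ∀ {n r} (G : SimpleGraph n) k (c : Fin n → Fin r) →
  sumFin r (classPowerSum G k c) ≡ powerSum G k
classPowerSums-sum G k c = partitionSum c (λ v → degree G v ^ k)

classSize≤n : ∀ {n r} (c : Fin n → Fin r) i → classSize c i ≤ n
classSize≤n {n} c i =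
  ≤-trans (restricted≤total (λ v → ⌊ c v ≟ i ⌋) (λ _ → 1))
          (≤-reflexive (trans (sumFin-const n 1) (*-identityʳ n)))

-- Monotonicity of power means

-- Rearrangement inequality: if a ≤ b and A ≤ B then a·B + b·A ≤ a·A + b·B
-- (writing b = a + p and B = A + q, the two sides differ exactly by p·q).
rearrangement : ∀ {a b A B} → a ≤ b → A ≤ B → a * B + b * A ≤ a * A + b * B
rearrangement {a} {A = A} a≤b A≤B with m≤n⇒∃[o]m+o≡n a≤b | m≤n⇒∃[o]m+o≡n A≤B
... | p , refl | q , refl = ≤-trans (m≤m+n _ (p * q)) (≤-reflexive
  (solve 4 (λ a p A q → a :* (A :+ q) :+ (a :+ p) :* A :+ p :* q := a :* A :+ (a :+ p) :* (A :+ q)) refl a p A q))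

rearrangement′ : ∀ a b A B → (a ≤ b → A ≤ B) → (b ≤ a → B ≤ A) → a * B + b * A ≤ a * A + b * B
rearrangement′ a b A B alike₁ alike₂ with ≤-total a b
... | inj₁ a≤b = rearrangement a≤b (alike₁ a≤b)
... | inj₂ b≤a = subst₂ _≤_ (+-comm (b * A) (a * B)) (+-comm (b * B) (a * A))
                   (rearrangement b≤a (alike₂ b≤a))

-- Weighted AM–GM inequality with weights k and 1: (k+1)·m·d^k ≤ k·d^(k+1) + m^(k+1).
-- The induction step multiplies by d and uses that (d, m) and (d^(k+1), m^(k+1))
-- are similarly ordered.
amgm : ∀ k d m → suc k * m * d ^ k ≤ k * d ^ suc k + m ^ suc k
amgm zero d m = ≤-reflexive (solve 1 (λ m → con 1 :* m :* con 1 := con 0 :+ m :* con 1) refl m)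
amgm (suc k) d m = begin
  suc (suc k) * m * d ^ suc k
    ≡⟨ solve 4 (λ k d m D → (con 2 :+ k) :* m :* (d :* D) := d :* ((con 1 :+ k) :* m :* D) :+ m :* (d :* D))
         refl k d m (d ^ k) ⟩
  d * (suc k * m * d ^ k) + m * d ^ suc k
    ≤⟨ +-monoˡ-≤ _ (*-monoʳ-≤ d (amgm k d m)) ⟩
  d * (k * d ^ suc k + m ^ suc k) + m * d ^ suc k
    ≡⟨ solve 5 (λ k d m D M → d :* (k :* D :+ M) :+ m :* D := k :* (d :* D) :+ (d :* M :+ m :* D))
         refl k d m (d ^ suc k) (m ^ suc k) ⟩
  k * d ^ suc (suc k) + (d * m ^ suc k + m * d ^ suc k)
    ≤⟨ +-monoʳ-≤ (k * d ^ suc (suc k)) (rearrangement′ d m (d ^ suc k) (m ^ suc k) (^-monoˡ-≤ (suc k)) (^-monoˡ-≤ (suc k))) ⟩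
  k * d ^ suc (suc k) + (d * d ^ suc k + m * m ^ suc k)
    ≡⟨ solve 3 (λ k X Y → k :* X :+ (X :+ Y) := (con 1 :+ k) :* X :+ Y) refl k (d ^ suc (suc k)) (m ^ suc (suc k)) ⟩
  suc k * d ^ suc (suc k) + m ^ suc (suc k) ∎
  where open ≤-Reasoning

-- Summing AM–GM over B gives (k+1)·M·Σ x^k ≤ k·Σ x^(k+1) + |B|·M^(k+1) ≤ (k+1)·M·|B|·M^k.
powerMean-step : ∀ {N} (b : Fin N → Bool) (x : Fin N → ℕ) M k →
  restrictedSum b (λ v → x v ^ suc (suc k)) ≤ restrictedSum b (λ _ → 1) * M ^ suc (suc k) →
  restrictedSum b (λ v → x v ^ suc k) ≤ restrictedSum b (λ _ → 1) * M ^ suc k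
powerMean-step b x zero k small =
  ≤-trans (restricted-mono b (λ v → powerGrows (x v))) small
  where
  powerGrows : ∀ d → d ^ suc k ≤ d ^ suc (suc k)
  powerGrows zero    = z≤n
  powerGrows (suc d) = ^-monoʳ-≤ (suc d) (n≤1+n (suc k))
powerMean-step b x M@(suc _) k small = *-cancelˡ-≤ (suc K * M) (begin
  suc K * M * restrictedSum b (λ v → x v ^ K)
    ≡⟨ sym (restricted-*ˡ b (suc K * M) _) ⟩
  restrictedSum b (λ v → suc K * M * x v ^ K)
    ≤⟨ restricted-mono b (λ v → amgm K (x v) M) ⟩
  restrictedSum b (λ v → K * x v ^ suc K + M ^ suc K)
    ≡⟨ restricted-+ b _ _ ⟩
  restrictedSum b (λ v → K * x v ^ suc K) + restrictedSum b (λ _ → M ^ suc K)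
    ≡⟨ cong₂ _+_ (restricted-*ˡ b K _) (restricted-const b (M ^ suc K)) ⟩
  K * restrictedSum b (λ v → x v ^ suc K) + M ^ suc K * w
    ≤⟨ +-monoˡ-≤ _ (*-monoʳ-≤ K small) ⟩
  K * (w * M ^ suc K) + M ^ suc K * w
    ≡⟨ solve 4 (λ K M w P → K :* (w :* (M :* P)) :+ M :* P :* w := (con 1 :+ K) :* M :* (w :* P)) refl K M w (M ^ K) ⟩
  suc K * M * (w * M ^ K) ∎)
  where
  open ≤-Reasoning
  K = suc k
  w = restrictedSum b (λ _ → 1)

lowerExponent : ∀ {n} (G : SimpleGraph n) {k r} s → k ≤ s →
  HasSmallPartition G (suc s) r → HasSmallPartition G (suc k) r
lowerExponent G zero    z≤n   partition = partition
lowerExponent {n} G (suc s) k≤1+s partition with m≤n⇒m<n∨m≡n k≤1+s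
... | inj₂ refl       = partition
... | inj₁ (s≤s k≤s) = lowerExponent G s k≤s (stepDown partition)
  where
  stepDown : ∀ {r} → HasSmallPartition G (suc (suc s)) r → HasSmallPartition G (suc s) r
  stepDown (c , small) = c , λ i →
    proj₁ (small i) ,
    powerMean-step (λ v → ⌊ c v ≟ i ⌋) (degree G) (n ∸ classSize c i) s (proj₂ (small i))

-- With at most one class, the class is all of V(G) (or V(G) = ∅), so δ_k-smallness
-- forces every degree to vanish.
atMostOneClass : ∀ {n} (G : SimpleGraph n) k r → r ≤ 1 →
  HasSmallPartition G (suc k) r → powerSum G (suc k) ≡ 0
atMostOneClass {zero}  G k 0 _ _ = refl
atMostOneClass {suc n} G k 0 _ (c , _) with c zero
... | ()
atMostOneClass {n} G k 1 _ (c , small) = n≤0⇒n≡0 (begin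
  powerSum G (suc k)                        ≡⟨ sym (classPowerSums-sum G (suc k) c) ⟩
  classPowerSum G (suc k) c zero + 0        ≡⟨ +-identityʳ _ ⟩
  classPowerSum G (suc k) c zero            ≤⟨ proj₂ (small zero) ⟩
  w * (n ∸ w) ^ suc k                       ≡⟨ cong (λ m → w * m ^ suc k) noComplement ⟩
  w * 0                                     ≡⟨ *-zeroʳ w ⟩
  0                                         ∎)
  where
  open ≤-Reasoning
  w = classSize c zero
  noComplement : n ∸ w ≡ 0
  noComplement = trans (cong (_∸ w) (sym (trans (sym (+-identityʳ w)) (classSizes-sum c)))) (n∸n≡0 w)
atMostOneClass G k (suc (suc r)) (s≤s ()) _

edgelessBound : ∀ {n} (G : SimpleGraph n) r → powerSum G 4 ≡ 0 →
  r ^ 4 * powerSum G 4 ≤ n ^ 5 * (r ∸ 1) ^ 4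
edgelessBound G r P≡0 rewrite P≡0 | *-zeroʳ (r ^ 4) = z≤n

-- Three classes

-- For classes of sizes a, b, x: Σ |W|·(n − |W|)^4 with n = a + b + x.
threeClassSum : ℕ → ℕ → ℕ → ℕ
threeClassSum a b x = a * (b + x) ^ 4 + b * (a + x) ^ 4 + x * (a + b) ^ 4

-- The inequality 3^4·Σ |W|·(n − |W|)^4 ≤ 2^4·n^5, i.e. the bound for r = 3.
ThreeClassBound : ℕ → ℕ → ℕ → Set
ThreeClassBound a b x = 81 * threeClassSum a b x ≤ 16 * (a + b + x) ^ 5

-- For sorted sizes a = x + p + q ≥ b = x + p ≥ x the difference of the two sides is
-- an explicit polynomial in x, p, q with nonnegative coefficients.
threeClassBound-sorted : ∀ x p q → ThreeClassBound (x + p + q) (x + p) x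
threeClassBound-sorted x p q = ≤-trans (m≤m+n _ _) (≤-reflexive
  (solve 3 (λ x p q → con 81 :* ((x :+ p :+ q) :* ((x :+ p) :+ x) :^ 4 :+ (x :+ p) :* ((x :+ p :+ q) :+ x) :^ 4 :+ x :* ((x :+ p :+ q) :+ (x :+ p)) :^ 4)
     :+ (con 432 :* x :^ 3 :* p :^ 2 :+ con 432 :* x :^ 3 :* p :* q :+ con 432 :* x :^ 3 :* q :^ 2
       :+ con 1152 :* x :^ 2 :* p :^ 3 :+ con 1728 :* x :^ 2 :* p :^ 2 :* q :+ con 864 :* x :^ 2 :* p :* q :^ 2 :+ con 144 :* x :^ 2 :* q :^ 3
       :+ con 1086 :* x :* p :^ 4 :+ con 2172 :* x :* p :^ 3 :* q :+ con 1386 :* x :* p :^ 2 :* q :^ 2 :+ con 300 :* x :* p :* q :^ 3 :+ con 78 :* x :* q :^ 4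
       :+ con 350 :* p :^ 5 :+ con 875 :* p :^ 4 :* q :+ con 794 :* p :^ 3 :* q :^ 2 :+ con 316 :* p :^ 2 :* q :^ 3 :+ con 79 :* p :* q :^ 4 :+ con 16 :* q :^ 5)
     := con 16 :* ((x :+ p :+ q) :+ (x :+ p) :+ x) :^ 5) refl x p q))

-- The bound is symmetric in the three sizes; two transpositions generate all orders.
threeClassBound-swap₁₂ : ∀ a b x → ThreeClassBound a b x → ThreeClassBound b a x
threeClassBound-swap₁₂ a b x = subst₂ _≤_
  (cong (81 *_) (solve 3 (λ a b x → a :* (b :+ x) :^ 4 :+ b :* (a :+ x) :^ 4 :+ x :* (a :+ b) :^ 4
                               := b :* (a :+ x) :^ 4 :+ a :* (b :+ x) :^ 4 :+ x :* (b :+ a) :^ 4) refl a b x))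
  (cong (λ n → 16 * n ^ 5) (solve 3 (λ a b x → a :+ b :+ x := b :+ a :+ x) refl a b x))

threeClassBound-swap₂₃ : ∀ a b x → ThreeClassBound a b x → ThreeClassBound a x b
threeClassBound-swap₂₃ a b x = subst₂ _≤_
  (cong (81 *_) (solve 3 (λ a b x → a :* (b :+ x) :^ 4 :+ b :* (a :+ x) :^ 4 :+ x :* (a :+ b) :^ 4
                               := a :* (x :+ b) :^ 4 :+ x :* (a :+ b) :^ 4 :+ b :* (a :+ x) :^ 4) refl a b x))
  (cong (λ n → 16 * n ^ 5) (solve 3 (λ a b x → a :+ b :+ x := a :+ x :+ b) refl a b x))

threeClassBound-ordered : ∀ a b x → x ≤ b → b ≤ a → ThreeClassBound a b x
threeClassBound-ordered a b x x≤b b≤a with m≤n⇒∃[o]m+o≡n x≤b | m≤n⇒∃[o]m+o≡n b≤a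
... | p , refl | q , refl = threeClassBound-sorted x p q

threeClassBound : ∀ a b x → ThreeClassBound a b x
threeClassBound a b x with ≤-total b a | ≤-total x b | ≤-total x a
... | inj₁ b≤a | inj₁ x≤b | _        = threeClassBound-ordered a b x x≤b b≤a
... | inj₁ b≤a | inj₂ b≤x | inj₁ x≤a = threeClassBound-swap₂₃ a x b (threeClassBound-ordered a x b b≤x x≤a)
... | inj₁ b≤a | inj₂ b≤x | inj₂ a≤x =
  threeClassBound-swap₂₃ a x b (threeClassBound-swap₁₂ x a b (threeClassBound-ordered x a b b≤a a≤x))
... | inj₂ a≤b | inj₁ x≤b | inj₁ x≤a =
  threeClassBound-swap₁₂ b a x (threeClassBound-ordered b a x x≤a a≤b)
... | inj₂ a≤b | inj₁ x≤b | inj₂ a≤x =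
  threeClassBound-swap₁₂ b a x (threeClassBound-swap₂₃ b x a (threeClassBound-ordered b x a a≤x x≤b))
... | inj₂ a≤b | inj₂ b≤x | _        =
  threeClassBound-swap₁₂ b a x (threeClassBound-swap₂₃ b x a
    (threeClassBound-swap₁₂ x b a (threeClassBound-ordered x b a a≤b b≤x)))

threeClasses : ∀ {n} (w S : Fin 3 → ℕ) → sumFin 3 w ≡ n →
  (∀ i → S i ≤ w i * (n ∸ w i) ^ 4) → 3 ^ 4 * sumFin 3 S ≤ n ^ 5 * 2 ^ 4
threeClasses w S refl small = begin
  3 ^ 4 * sumFin 3 S
    ≤⟨ *-monoʳ-≤ (3 ^ 4) (sumFin-mono 3 small) ⟩
  3 ^ 4 * (w₀ * (n ∸ w₀) ^ 4 + (w₁ * (n ∸ w₁) ^ 4 + (w₂ * (n ∸ w₂) ^ 4 + 0)))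
    ≡⟨ cong₂ (λ u v → 3 ^ 4 * (w₀ * u ^ 4 + (w₁ * v ^ 4 + (w₂ * (n ∸ w₂) ^ 4 + 0)))) complement₀ complement₁ ⟩
  3 ^ 4 * (w₀ * (w₁ + w₂) ^ 4 + (w₁ * (w₀ + w₂) ^ 4 + (w₂ * (n ∸ w₂) ^ 4 + 0)))
    ≡⟨ cong (λ z → 3 ^ 4 * (w₀ * (w₁ + w₂) ^ 4 + (w₁ * (w₀ + w₂) ^ 4 + (w₂ * z ^ 4 + 0)))) complement₂ ⟩
  3 ^ 4 * (w₀ * (w₁ + w₂) ^ 4 + (w₁ * (w₀ + w₂) ^ 4 + (w₂ * (w₀ + w₁) ^ 4 + 0)))
    ≡⟨ solve 3 (λ a b x → con 3 :^ 4 :* (a :* (b :+ x) :^ 4 :+ (b :* (a :+ x) :^ 4 :+ (x :* (a :+ b) :^ 4 :+ con 0)))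
                          := con 81 :* (a :* (b :+ x) :^ 4 :+ b :* (a :+ x) :^ 4 :+ x :* (a :+ b) :^ 4)) refl w₀ w₁ w₂ ⟩
  81 * threeClassSum w₀ w₁ w₂
    ≤⟨ threeClassBound w₀ w₁ w₂ ⟩
  16 * (w₀ + w₁ + w₂) ^ 5
    ≡⟨ solve 3 (λ a b x → con 16 :* (a :+ b :+ x) :^ 5 := (a :+ (b :+ (x :+ con 0))) :^ 5 :* con 2 :^ 4) refl w₀ w₁ w₂ ⟩
  n ^ 5 * 2 ^ 4 ∎
  where
  open ≤-Reasoning
  w₀ = w zero
  w₁ = w (suc zero)
  w₂ = w (suc (suc zero))
  n = w₀ + (w₁ + (w₂ + 0))
  complement₀ : n ∸ w₀ ≡ w₁ + w₂
  complement₀ = trans (m+n∸m≡n w₀ (w₁ + (w₂ + 0))) (cong (w₁ +_) (+-identityʳ w₂))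
  complement₁ : n ∸ w₁ ≡ w₀ + w₂
  complement₁ = trans (cong (_∸ w₁) (solve 3 (λ a b x → a :+ (b :+ (x :+ con 0)) := b :+ (a :+ x)) refl w₀ w₁ w₂))
                      (m+n∸m≡n w₁ (w₀ + w₂))
  complement₂ : n ∸ w₂ ≡ w₀ + w₁
  complement₂ = trans (cong (_∸ w₂) (solve 3 (λ a b x → a :+ (b :+ (x :+ con 0)) := x :+ (a :+ b)) refl w₀ w₁ w₂))
                      (m+n∸m≡n w₂ (w₀ + w₁))

-- Four or more classes

-- Tangent-line bound for f(x) = x·(1 − x)^4 at x = 1/r, r = 4 + t, scaled by r^5·n^5:
-- with n = w + m, a = r − 1 and C = a^3·n^4,
--   r^5·w·m^4 ≤ n^5·a^4 + C·(r − 5)·(r·w − n),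
-- the signed linear term being split between the two sides.  The difference of the
-- sides is (a·w − m)^2 times a cubic with nonnegative coefficients.
tangentLine : ∀ t w m →
  (4 + t) ^ 5 * (w * m ^ 4) + (3 + t) ^ 3 * (w + m) ^ 4 * ((4 + t) * w + t * (w + m)) ≤
  (w + m) ^ 5 * (3 + t) ^ 4 + (3 + t) ^ 3 * (w + m) ^ 4 * (t * (4 + t) * w + (w + m))
tangentLine t w m = +-cancelʳ-≤ (square * cofactor) _ _ (begin
  lhs + square * cofactor  ≡⟨ certificate ⟩
  rhs + cross * cofactor   ≤⟨ +-monoʳ-≤ rhs (*-monoˡ-≤ cofactor (rearrangement′ (a * w) m (a * w) m id id)) ⟩
  rhs + square * cofactor  ∎)
  where
  open ≤-Reasoning
  a r n lhs rhs cross square cofactor : ℕ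
  a = 3 + t
  r = 4 + t
  n = w + m
  lhs = r ^ 5 * (w * m ^ 4) + a ^ 3 * n ^ 4 * (r * w + t * n)
  rhs = n ^ 5 * a ^ 4 + a ^ 3 * n ^ 4 * (t * r * w + n)
  cross = a * w * m + m * (a * w)
  square = a * w * (a * w) + m * m
  cofactor = 3 * (r * m) * n ^ 2 + 2 * (r * m) ^ 2 * n + (r * m) ^ 3 + 9 * t * n ^ 3 + 4 * t * (r * m) * n ^ 2
           + t * (r * m) ^ 2 * n + 6 * t ^ 2 * n ^ 3 + t ^ 2 * (r * m) * n ^ 2 + t ^ 3 * n ^ 3
  certificate : lhs + square * cofactor ≡ rhs + cross * cofactor
  certificate = solve 3 (λ t w m →
    let a = con 3 :+ t ; r = con 4 :+ t ; n = w :+ m ; rm = r :* m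
        Q = con 3 :* rm :* n :^ 2 :+ con 2 :* rm :^ 2 :* n :+ rm :^ 3 :+ con 9 :* t :* n :^ 3 :+ con 4 :* t :* rm :* n :^ 2
          :+ t :* rm :^ 2 :* n :+ con 6 :* t :^ 2 :* n :^ 3 :+ t :^ 2 :* rm :* n :^ 2 :+ t :^ 3 :* n :^ 3
    in r :^ 5 :* (w :* m :^ 4) :+ a :^ 3 :* n :^ 4 :* (r :* w :+ t :* n) :+ (a :* w :* (a :* w) :+ m :* m) :* Q
       := n :^ 5 :* a :^ 4 :+ a :^ 3 :* n :^ 4 :* (t :* r :* w :+ n) :+ (a :* w :* m :+ m :* (a :* w)) :* Q)
    refl t w m

classTangentLine : ∀ t {n w S} → w ≤ n → S ≤ w * (n ∸ w) ^ 4 →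
  (4 + t) ^ 5 * S + (3 + t) ^ 3 * n ^ 4 * ((4 + t) * w + t * n) ≤
  n ^ 5 * (3 + t) ^ 4 + (3 + t) ^ 3 * n ^ 4 * (t * (4 + t) * w + n)
classTangentLine t {n} {w} {S} w≤n S≤ =
  subst (λ N → (4 + t) ^ 5 * S + (3 + t) ^ 3 * N ^ 4 * ((4 + t) * w + t * N) ≤
               N ^ 5 * (3 + t) ^ 4 + (3 + t) ^ 3 * N ^ 4 * (t * (4 + t) * w + N))
        (m+[n∸m]≡n w≤n)
        (≤-trans (+-monoˡ-≤ _ (*-monoʳ-≤ ((4 + t) ^ 5) S≤)) (tangentLine t w (n ∸ w)))

sumFin-slack : ∀ r (A B B′ : Fin r → ℕ) K → (∀ i → A i + B i ≤ K + B′ i) →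
  sumFin r B ≡ sumFin r B′ → sumFin r A ≤ r * K
sumFin-slack r A B B′ K bound totals = +-cancelʳ-≤ (sumFin r B) _ _ (begin
  sumFin r A + sumFin r B          ≡⟨ sym (sumFin-+ r A B) ⟩
  sumFin r (λ i → A i + B i)       ≤⟨ sumFin-mono r bound ⟩
  sumFin r (λ i → K + B′ i)        ≡⟨ sumFin-+ r (λ _ → K) B′ ⟩
  sumFin r (λ _ → K) + sumFin r B′ ≡⟨ cong₂ _+_ (sumFin-const r K) (sym totals) ⟩
  r * K + sumFin r B               ∎)
  where open ≤-Reasoning

-- A δ_4-small partition into r = 4 + t classes gives r^4·Σ d^4 ≤ (r − 1)^4·n^5: sum the
-- tangent-line bounds over the classes; the linear terms cancel since Σ |Wᵢ| = n.
manyClasses : ∀ {n} (G : SimpleGraph n) t (c : Fin n → Fin (4 + t)) →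
  (∀ i → classPowerSum G 4 c i ≤ classSize c i * (n ∸ classSize c i) ^ 4) →
  (4 + t) ^ 4 * powerSum G 4 ≤ n ^ 5 * (3 + t) ^ 4
manyClasses {n} G t c small = *-cancelˡ-≤ r (begin
  r * (r ^ 4 * powerSum G 4)                 ≡⟨ sym (*-assoc r (r ^ 4) (powerSum G 4)) ⟩
  r ^ 5 * powerSum G 4                       ≡⟨ cong (r ^ 5 *_) (sym (classPowerSums-sum G 4 c)) ⟩
  r ^ 5 * sumFin r (classPowerSum G 4 c)     ≡⟨ sym (sumFin-*ˡ r (r ^ 5) (classPowerSum G 4 c)) ⟩
  sumFin r (λ i → r ^ 5 * classPowerSum G 4 c i)
    ≤⟨ sumFin-slack r _ (λ i → C * (r * w i + t * n)) (λ i → C * (t * r * w i + n)) _ perClass slackTotals ⟩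
  r * (n ^ 5 * a ^ 4)                        ∎)
  where
  open ≤-Reasoning
  a r C : ℕ
  a = 3 + t
  r = 4 + t
  C = a ^ 3 * n ^ 4
  w : Fin r → ℕ
  w = classSize c
  perClass : ∀ i → r ^ 5 * classPowerSum G 4 c i + C * (r * w i + t * n) ≤ n ^ 5 * a ^ 4 + C * (t * r * w i + n)
  perClass i = classTangentLine t (classSize≤n c i) (small i)
  slackTotals : sumFin r (λ i → C * (r * w i + t * n)) ≡ sumFin r (λ i → C * (t * r * w i + n))
  slackTotals = begin-equality
    sumFin r (λ i → C * (r * w i + t * n))    ≡⟨ sumFin-*ˡ r C (λ i → r * w i + t * n) ⟩
    C * sumFin r (λ i → r * w i + t * n)      ≡⟨ cong (C *_) (sumFin-affine r w r (t * n)) ⟩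
    C * (r * sumFin r w + r * (t * n))        ≡⟨ cong (λ s → C * (r * s + r * (t * n))) (classSizes-sum c) ⟩
    C * (r * n + r * (t * n))                 ≡⟨ cong (C *_) (solve 3 (λ r t n → r :* n :+ r :* (t :* n) := t :* r :* n :+ r :* n) refl r t n) ⟩
    C * (t * r * n + r * n)                   ≡⟨ cong (λ s → C * (t * r * s + r * n)) (sym (classSizes-sum c)) ⟩
    C * (t * r * sumFin r w + r * n)          ≡⟨ cong (C *_) (sym (sumFin-affine r w (t * r) n)) ⟩
    C * sumFin r (λ i → t * r * w i + n)      ≡⟨ sym (sumFin-*ˡ r C (λ i → t * r * w i + n)) ⟩
    sumFin r (λ i → C * (t * r * w i + n))    ∎

-- Every δ_4-small partition into r classes satisfies r^4·Σ d^4 ≤ (r − 1)^4·n^5,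
-- provided φ^(4)(G) ≠ 2.  For r = 2 the bound can fail, but then φ^(4)(G) ≤ 1 and G
-- is edgeless.
partitionBound : ∀ {n} (G : SimpleGraph n) φ₄ → IsPhi G 4 φ₄ → φ₄ ≢ 2 →
  ∀ r → HasSmallPartition G 4 r → r ^ 4 * powerSum G 4 ≤ n ^ 5 * (r ∸ 1) ^ 4
partitionBound G φ₄ _ _ 0 partition = edgelessBound G 0 (atMostOneClass G 3 0 z≤n partition)
partitionBound G φ₄ _ _ 1 partition = edgelessBound G 1 (atMostOneClass G 3 1 ≤-refl partition)
partitionBound G φ₄ (partition₄ , minimal₄) φ₄≢2 2 partition =
  edgelessBound G 2 (atMostOneClass G 3 φ₄ φ₄≤1 partition₄)
  where
  φ₄≤1 : φ₄ ≤ 1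
  φ₄≤1 = ≤-pred (≤∧≢⇒< (minimal₄ 2 partition) φ₄≢2)
partitionBound {n} G φ₄ _ _ 3 (c , small) =
  subst (λ P → 3 ^ 4 * P ≤ n ^ 5 * 2 ^ 4) (classPowerSums-sum G 4 c)
        (threeClasses (classSize c) (classPowerSum G 4 c) (classSizes-sum c) (proj₂ ∘ small))
partitionBound G φ₄ _ _ (suc (suc (suc (suc t)))) (c , small) = manyClasses G t c (proj₂ ∘ small)

-- Corollary 4.7: φ^(s)(G) ≥ n / (n − D_4(G)) for s ≥ 4, in the cleared form
-- φ^4·Σ d^4 ≤ n^5·(φ − 1)^4.  An optimal δ_s-small partition is δ_4-small, and
-- partitionBound applies to it.
corollary4p7 : ∀ {n} (G : SimpleGraph n) (φ₄ : ℕ) → IsPhi G 4 φ₄ → φ₄ ≢ 2 →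
    ∀ (s φₛ : ℕ) → 4 ≤ s → IsPhi G s φₛ →
    φₛ ^ 4 * powerSum G 4 ≤ n ^ 5 * (φₛ ∸ 1) ^ 4
corollary4p7 G φ₄ isPhi₄ φ₄≢2 (suc s) φₛ (s≤s 3≤s) (partitionₛ , _) =
  partitionBound G φ₄ isPhi₄ φ₄≢2 φₛ (lowerExponent G s 3≤s partitionₛ)
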